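{- Let $G$ be a graph and let $n_1,\ldots,n_t$ be as defined in the context. Then $$D(G)\leq D(G+G)\leq D(G)+\max\{n_1,\ldots,n_t\}.$$
   Context: All graphs are finite and simple. $G+G$ denotes the join of $G$ with a disjoint copy of itself: vertex set the disjoint union of the two vertex sets, edges all edges of both copies together with all pairs with one end in each copy. $D(\cdot)$ is the distinguishing number: the least $r$ such that there is a labeling $V\to\{1,\ldots,r\}$ preserved by no non-identity automorphism. Write $\Gamma=G+G$ and let $V_1$ be the vertex set of the first copy. For a vertex $v$, $N_\Gamma(v)$ is its neighbourhood and $\overline{N_\Gamma(v)}=V(\Gamma)\setminus N_\Gamma(v)$. Partition of $V_1$: choose $v_1\in V_1$, set $A:=\overline{N_\Gamma(v_1)}$; while some vertex $v$ satisfies $\overline{N_\Gamma(v)}\cap A\neq\emptyset$ and $\overline{N_\Gamma(v)}\not\subseteq A$, replace $A$ by $A\cup\overline{N_\Gamma(v)}$; the final set is $A_1$. Then choose a vertex of $V_1$ outside $A_1$ and repeat to get $A_2$, etc., giving $V_1=A_1\cup\cdots\cup A_k$. Partition $\{\Gamma[A_1],\ldots,\Gamma[A_k]\}$ into isomorphism classes $\mathcal{A}_1,\ldots,\mathcal{A}_t$ (members in the same class iff isomorphic), and let $n_i=|\mathcal{A}_i|$. -}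

module Defs where

open import Data.Bool using (Bool; true; false; not; T)
open import Data.Nat using (ℕ; _≤_)
open import Data.Fin using (Fin) renaming (_<_ to _<ᶠ_)
open import Data.Sum using (_⊎_; inj₁; inj₂)
open import Data.Product using (Σ; ∃; ∃-syntax; _×_; _,_; proj₁)
open import Relation.Nullary using (¬_)
open import Relation.Binary.PropositionalEquality using (_≡_)
open import Function.Bundles using (_↔_; Inverse)
open import Function.Definitions using (Injective)

record Graph (V : Set) : Set where
  field
    adj    : V → V → Bool
    sym    : ∀ u v → adj u v ≡ adj v u
    irrefl : ∀ v → adj v v ≡ false
open Graph public

Iso : {V W : Set} → Graph V → Graph W → Set
Iso {V} {W} G H =
  Σ (V ↔ W) λ f → ∀ u v → adj H (Inverse.to f u) (Inverse.to f v) ≡ adj G u v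

Aut : {V : Set} → Graph V → Set
Aut G = Iso G G

Distinguishing : {V : Set} (G : Graph V) {r : ℕ} → (V → Fin r) → Set
Distinguishing {V} G ℓ =
  (σ : Aut G) → (∀ v → ℓ (Inverse.to (proj₁ σ) v) ≡ ℓ v) →
  ∀ v → Inverse.to (proj₁ σ) v ≡ v

IsDistNum : {V : Set} → Graph V → ℕ → Set
IsDistNum {V} G r =
  (Σ (V → Fin r) (Distinguishing G)) ×
  (∀ s (ℓ : V → Fin s) → Distinguishing G ℓ → r ≤ s)

joinAdj : {V : Set} → Graph V → V ⊎ V → V ⊎ V → Bool
joinAdj G (inj₁ u) (inj₁ v) = adj G u v
joinAdj G (inj₂ u) (inj₂ v) = adj G u v
joinAdj G (inj₁ u) (inj₂ v) = true
joinAdj G (inj₂ u) (inj₁ v) = true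

joinSym : {V : Set} (G : Graph V) → ∀ u v → joinAdj G u v ≡ joinAdj G v u
joinSym G (inj₁ u) (inj₁ v) = sym G u v
joinSym G (inj₂ u) (inj₂ v) = sym G u v
joinSym G (inj₁ u) (inj₂ v) = Relation.Binary.PropositionalEquality.refl
joinSym G (inj₂ u) (inj₁ v) = Relation.Binary.PropositionalEquality.refl

joinIrrefl : {V : Set} (G : Graph V) → ∀ v → joinAdj G v v ≡ false
joinIrrefl G (inj₁ v) = irrefl G v
joinIrrefl G (inj₂ v) = irrefl G v

double : {V : Set} → Graph V → Graph (V ⊎ V)
double G = record { adj = joinAdj G ; sym = joinSym G ; irrefl = joinIrrefl G }

Subset : Set → Set
Subset V = V → Bool

_⊆_ : {V : Set} → Subset V → Subset V → Set
A ⊆ B = ∀ u → T (A u) → T (B u)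

Induced : {V : Set} (Γ : Graph V) (A : Subset V) → Graph (Σ V (λ v → T (A v)))
Induced Γ A = record
  { adj = λ { (u , _) (v , _) → adj Γ u v }
  ; sym = λ { (u , _) (v , _) → sym Γ u v }
  ; irrefl = λ { (v , _) → irrefl Γ v } }

-- Complement of the neighbourhood: V(Γ) ∖ N_Γ(v)  (contains v itself).
coNbr : {V : Set} → Graph V → V → Subset V
coNbr Γ v u = not (adj Γ v u)

Closed : {V : Set} → Graph V → Subset V → Set
Closed {V} Γ A =
  ∀ v → (∃[ u ] (T (coNbr Γ v u) × T (A u))) → coNbr Γ v ⊆ A

-- A is the final set produced by the growth procedure started at v:
-- the least closed set containing the co-neighbourhood of v.
IsGrownFrom : {V : Set} → Graph V → V → Subset V → Set
IsGrownFrom Γ v A =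
  (coNbr Γ v ⊆ A) × Closed Γ A ×
  (∀ B → Closed Γ B → coNbr Γ v ⊆ B → A ⊆ B)

IsPartitionSeq : {n : ℕ} → Graph (Fin n) → (k : ℕ) →
                 (Fin k → Subset (Fin n ⊎ Fin n)) → Set
IsPartitionSeq {n} G k A =
  (∀ i → ∃[ v ] ((∀ j → j <ᶠ i → ¬ T (A j (inj₁ v))) ×
                 IsGrownFrom (double G) (inj₁ v) (A i))) ×
  (∀ (v : Fin n) → ∃[ i ] T (A i (inj₁ v)))

ClassSize : {n : ℕ} → Graph (Fin n) → (k : ℕ) →
            (Fin k → Subset (Fin n ⊎ Fin n)) → Fin k → ℕ → Set
ClassSize G k A i c =
  Σ (Fin c → Fin k) λ f →
    Injective _≡_ _≡_ f ×
    (∀ x → Iso (Induced (double G) (A (f x))) (Induced (double G) (A i))) ×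
    (∀ j → Iso (Induced (double G) (A j)) (Induced (double G) (A i)) →
           ∃[ x ] f x ≡ j)

IsMaxClassSize : {n : ℕ} → Graph (Fin n) → (k : ℕ) →
                 (Fin k → Subset (Fin n ⊎ Fin n)) → ℕ → Set
IsMaxClassSize G k A m =
  (∀ i c → ClassSize G k A i c → c ≤ m) × (∃[ i ] ClassSize G k A i m)

-- Lower bound: an automorphism of G extends to G + G by acting on the first
-- copy only, so a distinguishing labeling of G + G restricts to one of G.
--
-- Upper bound: label both copies by a distinguishing labeling of G, except
-- that the vertex from which each piece A_i was grown gets a fresh label:
-- the number of earlier pieces isomorphic to Γ[A_i], which is < max n_i.
-- A label-preserving automorphism φ must send the root of A_i to the root of
-- an isomorphic piece with the same number, i.e. it fixes every root.  Since
-- the first copy is closed under the growth step and A_i is the least closed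
-- set around its root, φ maps every A_i, hence the whole first copy, into
-- itself.  On each copy φ then restricts to an automorphism of G preserving
-- the labeling of G, which is the identity.
module Submission where

open import Defs
open import Data.Bool using (true; false; not; T)
open import Data.Bool.Properties using (T-irrelevant)
open import Data.Fin using (Fin; zero; suc; toℕ; fromℕ<; join)
  renaming (_<_ to _<ᶠ_)
open import Data.Fin.Properties
  using (_≟_; _<?_; <-cmp; suc-injective; toℕ-fromℕ<; +↔⊎)
  renaming (<-trans to <ᶠ-trans; <-irrefl to <ᶠ-irrefl)
open import Data.Nat using (ℕ; zero; suc; _≤_; _<_; _+_; z≤n; s≤s; _≤?_)
open import Data.Nat.Properties using (m≤n⇒m≤1+n; m<n⇒m<1+n; <-≤-trans; <⇒≢)
open import Data.Product using (Σ; ∃; ∃-syntax; _×_; _,_; proj₁; proj₂)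
open import Data.Sum using (_⊎_; inj₁; inj₂; reduce)
open import Data.Sum.Function.Propositional using (_⊎-↔_)
open import Data.Sum.Properties using (inj₁-injective; inj₂-injective)
open import Function using (_∘_)
open import Function.Bundles using (_↔_; Inverse; Injection)
open import Function.Definitions using (Injective)
open import Function.Properties.Inverse using (↔-refl; ↔-sym; ↔-trans; ↔⇒↣)
open import Level using (0ℓ)
open import Relation.Binary using (Rel; tri<; tri≈; tri>)
open import Relation.Binary.Structures using (IsEquivalence)
open import Relation.Binary.PropositionalEquality as ≡ using (_≡_; refl; cong; cong₂; subst)
open import Relation.Nullary using (¬_; Dec; yes; no; contradiction)
open import Relation.Nullary.Decidable using (_×-dec_; decidable-stable; ¬¬-excluded-middle)
open import Relation.Nullary.Negation using (¬¬-map)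
open import Relation.Unary using (Pred; Decidable)

open Inverse using (to; from; strictlyInverseˡ; strictlyInverseʳ)

to-injective : {X Y : Set} (f : X ↔ Y) → Injective _≡_ _≡_ (to f)
to-injective f = Injection.injective (↔⇒↣ f)

T-not⁺ : ∀ {b} → ¬ T b → T (not b)
T-not⁺ {false} _  = _
T-not⁺ {true}  ¬b = ¬b _

T-not⁻ : ∀ {b} → T (not b) → ¬ T b
T-not⁻ {false} _ ()

¬¬-Π : ∀ {k} {P : Fin k → Set} → (∀ i → ¬ ¬ P i) → ¬ ¬ (∀ i → P i)
¬¬-Π {zero}  ¬¬P ¬∀P = ¬∀P (λ ())
¬¬-Π {suc k} ¬¬P ¬∀P = ¬¬P zero λ P₀ →
  ¬¬-Π (¬¬P ∘ suc) λ P₊ → ¬∀P λ { zero → P₀ ; (suc i) → P₊ i }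

Iso-refl : {V : Set} (G : Graph V) → Iso G G
Iso-refl G = ↔-refl , λ _ _ → refl

Iso-sym : {V W : Set} (G : Graph V) (H : Graph W) → Iso G H → Iso H G
Iso-sym _ H (f , f-adj) = ↔-sym f , λ u v →
  ≡.trans (≡.sym (f-adj _ _)) (cong₂ (adj H) (strictlyInverseˡ f u) (strictlyInverseˡ f v))

Iso-trans : {U V W : Set} (F : Graph U) (G : Graph V) (H : Graph W) →
            Iso F G → Iso G H → Iso F H
Iso-trans _ _ _ (f , f-adj) (g , g-adj) = ↔-trans f g , λ u v → ≡.trans (g-adj _ _) (f-adj u v)

Aut-restrict : {V W : Set} (H : Graph V) (Γ : Graph W) (ι : V → W) → Injective _≡_ _≡_ ι →
  (∀ u v → adj Γ (ι u) (ι v) ≡ adj H u v) → (φ : Aut Γ) →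
  (∀ u → ∃[ v ] ι v ≡ to (proj₁ φ) (ι u)) → (∀ u → ∃[ v ] ι v ≡ from (proj₁ φ) (ι u)) →
  Σ (Aut H) λ ψ → ∀ u → ι (to (proj₁ ψ) u) ≡ to (proj₁ φ) (ι u)
Aut-restrict {V} H Γ ι ι-injective ι-adj (f , f-adj) to-ι from-ι =
  (record { to = ψ ; from = ψ⁻¹ ; to-cong = cong ψ ; from-cong = cong ψ⁻¹
          ; inverse = (λ { refl → ψψ⁻¹ _ }) , (λ { refl → ψ⁻¹ψ _ }) } , ψ-adj) ,
  proj₂ ∘ to-ι
  where
  ψ ψ⁻¹ : V → V
  ψ   = proj₁ ∘ to-ι
  ψ⁻¹ = proj₁ ∘ from-ι
  ψψ⁻¹ : ∀ u → ψ (ψ⁻¹ u) ≡ u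
  ψψ⁻¹ u = ι-injective (≡.trans (proj₂ (to-ι (ψ⁻¹ u)))
    (≡.trans (cong (to f) (proj₂ (from-ι u))) (strictlyInverseˡ f (ι u))))
  ψ⁻¹ψ : ∀ u → ψ⁻¹ (ψ u) ≡ u
  ψ⁻¹ψ u = ι-injective (≡.trans (proj₂ (from-ι (ψ u)))
    (≡.trans (cong (from f) (proj₂ (to-ι u))) (strictlyInverseʳ f (ι u))))
  ψ-adj : ∀ u v → adj H (ψ u) (ψ v) ≡ adj H u v
  ψ-adj u v = begin
    adj H (ψ u) (ψ v)               ≡⟨ ≡.sym (ι-adj (ψ u) (ψ v)) ⟩
    adj Γ (ι (ψ u)) (ι (ψ v))       ≡⟨ cong₂ (adj Γ) (proj₂ (to-ι u)) (proj₂ (to-ι v)) ⟩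
    adj Γ (to f (ι u)) (to f (ι v)) ≡⟨ f-adj (ι u) (ι v) ⟩
    adj Γ (ι u) (ι v)               ≡⟨ ι-adj u v ⟩
    adj H u v                       ∎
    where open ≡.≡-Reasoning

-- The growth closure

module Growth {W : Set} (H : Graph W) where

  coNbr-refl : ∀ v → T (coNbr H v v)
  coNbr-refl v = subst (T ∘ not) (≡.sym (irrefl H v)) _

  grown-root : ∀ {v B} → IsGrownFrom H v B → T (B v)
  grown-root {v} (coNbr⊆B , _) = coNbr⊆B v (coNbr-refl v)

  grown-minimal : ∀ {v B} → IsGrownFrom H v B → (C : Subset W) → Closed H C → T (C v) → B ⊆ C
  grown-minimal {v} (_ , _ , least) C C-closed v∈C =
    least C C-closed (C-closed v (v , coNbr-refl v , v∈C))

  Closed-complement : (C : Subset W) → Closed H C → Closed H (not ∘ C)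
  Closed-complement C C-closed v (u , u∈N̄v , u∉C) w w∈N̄v =
    T-not⁺ λ w∈C → T-not⁻ u∉C (C-closed v (w , w∈N̄v , w∈C) u u∈N̄v)

  Closed-preimage : (φ : Aut H) (C : Subset W) → Closed H C → Closed H (C ∘ to (proj₁ φ))
  Closed-preimage (f , f-adj) C C-closed v (u , u∈N̄v , φu∈C) w w∈N̄v =
    C-closed (to f v) (to f u , image u u∈N̄v , φu∈C) (to f w) (image w w∈N̄v)
    where
    image : ∀ u → T (coNbr H v u) → T (coNbr H (to f v) (to f u))
    image u = subst (T ∘ not) (≡.sym (f-adj v u))

  Induced-≡ : {B : Subset W} {x y : W} → x ≡ y → (x∈B : T (B x)) (y∈B : T (B y)) →
              _≡_ {A = Σ W (T ∘ B)} (x , x∈B) (y , y∈B)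
  Induced-≡ refl x∈B y∈B = cong (_ ,_) (T-irrelevant x∈B y∈B)

  grown-Iso : (φ : Aut H) {v w : W} {B C : Subset W} → to (proj₁ φ) v ≡ w →
              IsGrownFrom H v B → IsGrownFrom H w C → Iso (Induced H B) (Induced H C)
  grown-Iso φ@(f , f-adj) {v} {w} {B} {C} φv≡w B-grown C-grown =
    record { to = φ↾ ; from = φ⁻¹↾ ; to-cong = cong φ↾ ; from-cong = cong φ⁻¹↾
           ; inverse = (λ { refl → Induced-≡ (strictlyInverseˡ f _) _ _ })
                     , (λ { refl → Induced-≡ (strictlyInverseʳ f _) _ _ }) } ,
    λ { (x , _) (y , _) → f-adj x y }
    where
    B⊆φ⁻¹C : B ⊆ (C ∘ to f)
    B⊆φ⁻¹C = grown-minimal B-grown (C ∘ to f) (Closed-preimage φ C (proj₁ (proj₂ C-grown)))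
      (subst (T ∘ C) (≡.sym φv≡w) (grown-root C-grown))
    C⊆φB : C ⊆ (B ∘ from f)
    C⊆φB = grown-minimal C-grown (B ∘ from f)
      (Closed-preimage (Iso-sym H H φ) B (proj₁ (proj₂ B-grown)))
      (subst (T ∘ B) (≡.trans (≡.sym (strictlyInverseʳ f v)) (cong (from f) φv≡w))
        (grown-root B-grown))
    φ↾ : Σ W (T ∘ B) → Σ W (T ∘ C)
    φ↾ (x , x∈B) = to f x , B⊆φ⁻¹C x x∈B
    φ⁻¹↾ : Σ W (T ∘ C) → Σ W (T ∘ B)
    φ⁻¹↾ (y , y∈C) = from f y , C⊆φB y y∈C

inFirst : {V : Set} → Subset (V ⊎ V)
inFirst (inj₁ _) = true
inFirst (inj₂ _) = false

inFirst⁻ : {V : Set} {x : V ⊎ V} → T (inFirst x) → ∃[ v ] inj₁ v ≡ x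
inFirst⁻ {x = inj₁ v} _ = v , refl

module _ {n : ℕ} (G : Graph (Fin n)) where

  inFirst-closed : Closed (double G) inFirst
  inFirst-closed (inj₁ _) _ (inj₁ _) _ = _
  inFirst-closed (inj₁ _) _ (inj₂ _) ()
  inFirst-closed (inj₂ _) (inj₁ _ , () , _)
  inFirst-closed (inj₂ _) (inj₂ _ , _ , ())

  Aut-extend : Aut G → Aut (double G)
  Aut-extend (f , f-adj) = (f ⊎-↔ ↔-refl) , adj-preserved
    where
    adj-preserved : ∀ x y → joinAdj G (to (f ⊎-↔ ↔-refl) x) (to (f ⊎-↔ ↔-refl) y) ≡ joinAdj G x y
    adj-preserved (inj₁ u) (inj₁ v) = f-adj u v
    adj-preserved (inj₁ _) (inj₂ _) = refl
    adj-preserved (inj₂ _) (inj₁ _) = refl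
    adj-preserved (inj₂ _) (inj₂ _) = refl

  Distinguishing-first : ∀ {r} (ℓ : Fin n ⊎ Fin n → Fin r) →
                         Distinguishing (double G) ℓ → Distinguishing G (ℓ ∘ inj₁)
  Distinguishing-first ℓ ℓ-dist σ σ-preserves v =
    inj₁-injective (ℓ-dist (Aut-extend σ) preserves (inj₁ v))
    where
    preserves : ∀ x → ℓ (to (proj₁ (Aut-extend σ)) x) ≡ ℓ x
    preserves (inj₁ u) = σ-preserves u
    preserves (inj₂ _) = refl

inj₂-preserved : {X Y : Set} (f : (X ⊎ Y) ↔ (X ⊎ Y)) → (∀ x → to f (inj₁ x) ≡ inj₁ x) →
                 ∀ y → ∃[ y′ ] inj₂ y′ ≡ to f (inj₂ y)
inj₂-preserved f fixes y with to f (inj₂ y) in fy≡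
... | inj₂ y′ = y′ , refl
... | inj₁ x  with () ← to-injective f (≡.trans fy≡ (≡.sym (fixes x)))

from-fixes : {X Y : Set} (f : (X ⊎ Y) ↔ (X ⊎ Y)) → (∀ x → to f (inj₁ x) ≡ inj₁ x) →
             ∀ x → from f (inj₁ x) ≡ inj₁ x
from-fixes f fixes x = ≡.trans (cong (from f) (≡.sym (fixes x))) (strictlyInverseʳ f (inj₁ x))

-- Counting and enumerating decidable subsets of Fin k

count : ∀ {k} {P : Pred (Fin k) 0ℓ} → Decidable P → ℕ
count {zero}  P? = 0
count {suc k} P? with P? zero
... | yes _ = suc (count (P? ∘ suc))
... | no  _ = count (P? ∘ suc)

count-mono : ∀ {k} {P Q : Pred (Fin k) 0ℓ} (P? : Decidable P) (Q? : Decidable Q) →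
             (∀ {j} → P j → Q j) → count P? ≤ count Q?
count-mono {zero}  P? Q? P⊆Q = z≤n
count-mono {suc k} P? Q? P⊆Q with P? zero | Q? zero
... | yes _  | yes _   = s≤s (count-mono (P? ∘ suc) (Q? ∘ suc) P⊆Q)
... | yes P₀ | no ¬Q₀  = contradiction (P⊆Q P₀) ¬Q₀
... | no _   | yes _   = m≤n⇒m≤1+n (count-mono (P? ∘ suc) (Q? ∘ suc) P⊆Q)
... | no _   | no _    = count-mono (P? ∘ suc) (Q? ∘ suc) P⊆Q

count-strict : ∀ {k} {P Q : Pred (Fin k) 0ℓ} (P? : Decidable P) (Q? : Decidable Q) →
               (∀ {j} → P j → Q j) → ∀ j → Q j → ¬ P j → count P? < count Q?
count-strict {suc k} P? Q? P⊆Q zero Qj ¬Pj with P? zero | Q? zero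
... | yes P₀ | _      = contradiction P₀ ¬Pj
... | no _   | yes _  = s≤s (count-mono (P? ∘ suc) (Q? ∘ suc) P⊆Q)
... | no _   | no ¬Q₀ = contradiction Qj ¬Q₀
count-strict {suc k} P? Q? P⊆Q (suc j) Qj ¬Pj with P? zero | Q? zero
... | yes _  | yes _   = s≤s (count-strict (P? ∘ suc) (Q? ∘ suc) P⊆Q j Qj ¬Pj)
... | yes P₀ | no ¬Q₀  = contradiction (P⊆Q P₀) ¬Q₀
... | no _   | yes _   = m<n⇒m<1+n (count-strict (P? ∘ suc) (Q? ∘ suc) P⊆Q j Qj ¬Pj)
... | no _   | no _    = count-strict (P? ∘ suc) (Q? ∘ suc) P⊆Q j Qj ¬Pj

Enumeration : ∀ {k} → Pred (Fin k) 0ℓ → ℕ → Set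
Enumeration {k} P c = Σ (Fin c → Fin k) λ f →
  Injective _≡_ _≡_ f × (∀ x → P (f x)) × (∀ j → P j → ∃[ x ] f x ≡ j)

Enumeration-cons : ∀ {k c} {P : Pred (Fin (suc k)) 0ℓ} → P zero →
                   Enumeration (P ∘ suc) c → Enumeration P (suc c)
Enumeration-cons {k} {c} {P} P₀ (f , f-injective , f∈P , f-onto) = g , g-injective , g∈P , g-onto
  where
  g : Fin (suc c) → Fin (suc k)
  g zero    = zero
  g (suc x) = suc (f x)
  g-injective : Injective _≡_ _≡_ g
  g-injective {zero}  {zero}  _  = refl
  g-injective {suc _} {suc _} eq = cong suc (f-injective (suc-injective eq))
  g-injective {zero}  {suc _} ()
  g-injective {suc _} {zero}  ()
  g∈P : ∀ x → P (g x)
  g∈P zero    = P₀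
  g∈P (suc x) = f∈P x
  g-onto : ∀ j → P j → ∃[ x ] g x ≡ j
  g-onto zero    _  = zero , refl
  g-onto (suc j) Pj = let x , fx≡j = f-onto j Pj in suc x , cong suc fx≡j

Enumeration-skip : ∀ {k c} {P : Pred (Fin (suc k)) 0ℓ} → ¬ P zero →
                   Enumeration (P ∘ suc) c → Enumeration P c
Enumeration-skip {P = P} ¬P₀ (f , f-injective , f∈P , f-onto) =
  suc ∘ f , f-injective ∘ suc-injective , f∈P , onto
  where
  onto : ∀ j → P j → ∃[ x ] suc (f x) ≡ j
  onto zero    P₀ = contradiction P₀ ¬P₀
  onto (suc j) Pj = let x , fx≡j = f-onto j Pj in x , cong suc fx≡j

enumerate : ∀ {k} {P : Pred (Fin k) 0ℓ} (P? : Decidable P) → Enumeration P (count P?)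
enumerate {zero}  P? = (λ ()) , (λ { {()} }) , (λ ()) , (λ ())
enumerate {suc k} P? with P? zero
... | yes P₀ = Enumeration-cons P₀ (enumerate (P? ∘ suc))
... | no ¬P₀ = Enumeration-skip ¬P₀ (enumerate (P? ∘ suc))

-- Numbering the members of each class of an equivalence relation

module ClassRank {k : ℕ} {R : Rel (Fin k) 0ℓ} (R? : ∀ i j → Dec (R i j))
  (R-equiv : IsEquivalence R) {m : ℕ}
  (class-bounded : ∀ i c → Enumeration (λ j → R j i) c → c ≤ m) where

  open IsEquivalence R-equiv renaming (refl to R-refl; sym to R-sym; trans to R-trans)

  earlierInClass? : ∀ i → Decidable (λ j → j <ᶠ i × R j i)
  earlierInClass? i j = j <? i ×-dec R? j i

  rankℕ : Fin k → ℕ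
  rankℕ i = count (earlierInClass? i)

  rankℕ<m : ∀ i → rankℕ i < m
  rankℕ<m i = <-≤-trans
    (count-strict (earlierInClass? i) (λ j → R? j i) proj₂ i R-refl (<ᶠ-irrefl refl ∘ proj₁))
    (class-bounded i _ (enumerate (λ j → R? j i)))

  rankℕ-strict : ∀ {i j} → i <ᶠ j → R i j → rankℕ i < rankℕ j
  rankℕ-strict {i} {j} i<j iRj =
    count-strict (earlierInClass? i) (earlierInClass? j)
      (λ (l<i , lRi) → <ᶠ-trans l<i i<j , R-trans lRi iRj) i (i<j , iRj) (<ᶠ-irrefl refl ∘ proj₁)

  rank : Fin k → Fin m
  rank i = fromℕ< (rankℕ<m i)

  rankℕ-injective : ∀ {i j} → R i j → rankℕ i ≡ rankℕ j → i ≡ j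
  rankℕ-injective {i} {j} iRj rank≡ with <-cmp i j
  ... | tri< i<j _ _ = contradiction rank≡ (<⇒≢ (rankℕ-strict i<j iRj))
  ... | tri≈ _ i≡j _ = i≡j
  ... | tri> _ _ j<i = contradiction (≡.sym rank≡) (<⇒≢ (rankℕ-strict j<i (R-sym iRj)))

  rank-injective : ∀ {i j} → R i j → rank i ≡ rank j → i ≡ j
  rank-injective iRj rank≡ = rankℕ-injective iRj
    (≡.trans (≡.sym (toℕ-fromℕ< _)) (≡.trans (cong toℕ rank≡) (toℕ-fromℕ< _)))

module Pieces {n : ℕ} (G : Graph (Fin n)) {k : ℕ} (A : Fin k → Subset (Fin n ⊎ Fin n))
  (partition : IsPartitionSeq G k A) where

  open Growth (double G)

  root : Fin k → Fin n
  root i = proj₁ (proj₁ partition i)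

  root-fresh : ∀ {i j} → j <ᶠ i → ¬ T (A j (inj₁ (root i)))
  root-fresh {i} = proj₁ (proj₂ (proj₁ partition i)) _

  A-grown : ∀ i → IsGrownFrom (double G) (inj₁ (root i)) (A i)
  A-grown i = proj₂ (proj₂ (proj₁ partition i))

  piece : Fin n → Fin k
  piece v = proj₁ (proj₂ partition v)

  ∈-piece : ∀ v → T (A (piece v) (inj₁ v))
  ∈-piece v = proj₂ (proj₂ partition v)

  -- A_i lies inside the closed set V ∖ A_j, which contains its root.
  pieces-disjoint : ∀ {i j} → j <ᶠ i → ∀ x → T (A i x) → ¬ T (A j x)
  pieces-disjoint {i} {j} j<i x x∈Aᵢ = T-not⁻
    (grown-minimal (A-grown i) (not ∘ A j) (Closed-complement (A j) (proj₁ (proj₂ (A-grown j))))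
      (T-not⁺ (root-fresh j<i)) x x∈Aᵢ)

  piece-root : ∀ i → piece (root i) ≡ i
  piece-root i with <-cmp (piece (root i)) i
  ... | tri< p<i _ _ =
    contradiction (∈-piece (root i)) (pieces-disjoint p<i _ (grown-root (A-grown i)))
  ... | tri≈ _ p≡i _ = p≡i
  ... | tri> _ _ i<p =
    contradiction (grown-root (A-grown i)) (pieces-disjoint i<p _ (∈-piece (root i)))

-- A distinguishing labeling of G + G

module JoinLabeling {n : ℕ} (G : Graph (Fin n)) {k : ℕ} (A : Fin k → Subset (Fin n ⊎ Fin n))
  (partition : IsPartitionSeq G k A) {r : ℕ} (ℓ : Fin n → Fin r) (ℓ-dist : Distinguishing G ℓ)
  {m : ℕ} (rank : Fin k → Fin m)
  (rank-injective : ∀ {i j} → Iso (Induced (double G) (A i)) (Induced (double G) (A j)) →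
                    rank i ≡ rank j → i ≡ j) where

  open Pieces G A partition
  open Growth (double G)

  Γ : Graph (Fin n ⊎ Fin n)
  Γ = double G

  label : Fin n ⊎ Fin n → Fin r ⊎ Fin m
  label (inj₁ v) with v ≟ root (piece v)
  ... | yes _ = inj₂ (rank (piece v))
  ... | no  _ = inj₁ (ℓ v)
  label (inj₂ v) = inj₁ (ℓ v)

  label-root : ∀ i → label (inj₁ (root i)) ≡ inj₂ (rank i)
  label-root i with root i ≟ root (piece (root i))
  ... | yes _    = cong (inj₂ ∘ rank) (piece-root i)
  ... | no ¬root = contradiction (cong root (≡.sym (piece-root i))) ¬root

  label-nonroot : ∀ {v} → ¬ v ≡ root (piece v) → label (inj₁ v) ≡ inj₁ (ℓ v)
  label-nonroot {v} ¬root with v ≟ root (piece v)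
  ... | yes isRoot = contradiction isRoot ¬root
  ... | no _       = refl

  label≡inj₂ : ∀ x {c} → label x ≡ inj₂ c → ∃[ i ] x ≡ inj₁ (root i) × rank i ≡ c
  label≡inj₂ (inj₁ v) eq with v ≟ root (piece v)
  ... | yes isRoot = piece v , cong inj₁ isRoot , inj₂-injective eq
  ... | no _ with () ← eq
  label≡inj₂ (inj₂ v) ()

  label≡inj₁ : ∀ x {c} → label x ≡ inj₁ c → ℓ (reduce x) ≡ c
  label≡inj₁ (inj₁ v) eq with v ≟ root (piece v)
  ... | yes _ with () ← eq
  ... | no _ = inj₁-injective eq
  label≡inj₁ (inj₂ v) eq = inj₁-injective eq

  LabelPreserving : Aut Γ → Set
  LabelPreserving φ = ∀ x → label (to (proj₁ φ) x) ≡ label x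

  LabelPreserving-sym : ∀ φ → LabelPreserving φ → LabelPreserving (Iso-sym Γ Γ φ)
  LabelPreserving-sym (f , _) preserves x =
    ≡.trans (≡.sym (preserves (from f x))) (cong label (strictlyInverseˡ f x))

  module _ (φ : Aut Γ) (preserves : LabelPreserving φ) where

    -- The image of a root is the root of a piece isomorphic to it, of the same rank.
    fixes-roots : ∀ i → to (proj₁ φ) (inj₁ (root i)) ≡ inj₁ (root i)
    fixes-roots i =
      let j , φrootᵢ≡rootⱼ , rankⱼ≡rankᵢ = label≡inj₂ _ (≡.trans (preserves _) (label-root i))
          i≡j = rank-injective (grown-Iso φ φrootᵢ≡rootⱼ (A-grown i) (A-grown j)) (≡.sym rankⱼ≡rankᵢ)
      in ≡.trans φrootᵢ≡rootⱼ (cong (inj₁ ∘ root) (≡.sym i≡j))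

    maps-first-copy : ∀ u → ∃[ v ] inj₁ v ≡ to (proj₁ φ) (inj₁ u)
    maps-first-copy u = inFirst⁻
      (grown-minimal (A-grown (piece u)) (inFirst ∘ to (proj₁ φ))
        (Closed-preimage φ inFirst (inFirst-closed G))
        (subst (T ∘ inFirst) (≡.sym (fixes-roots (piece u))) _)
        (inj₁ u) (∈-piece u))

  fixes-first-copy : ∀ φ → LabelPreserving φ → ∀ v → to (proj₁ φ) (inj₁ v) ≡ inj₁ v
  fixes-first-copy φ preserves v =
    ≡.trans (≡.sym (ψ-commutes v)) (cong inj₁ (ℓ-dist ψ ψ-preserves-ℓ v))
    where
    restriction : Σ (Aut G) λ ψ → ∀ u → inj₁ (to (proj₁ ψ) u) ≡ to (proj₁ φ) (inj₁ u)
    restriction = Aut-restrict G Γ inj₁ inj₁-injective (λ _ _ → refl) φ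
      (maps-first-copy φ preserves) (maps-first-copy (Iso-sym Γ Γ φ) (LabelPreserving-sym φ preserves))
    ψ : Aut G
    ψ = proj₁ restriction
    ψ-commutes : ∀ u → inj₁ (to (proj₁ ψ) u) ≡ to (proj₁ φ) (inj₁ u)
    ψ-commutes = proj₂ restriction
    ψ-preserves-ℓ : ∀ u → ℓ (to (proj₁ ψ) u) ≡ ℓ u
    ψ-preserves-ℓ u with u ≟ root (piece u)
    ... | yes isRoot = cong ℓ (inj₁-injective (≡.trans (ψ-commutes u)
          (subst (λ w → to (proj₁ φ) (inj₁ w) ≡ inj₁ w) (≡.sym isRoot)
            (fixes-roots φ preserves (piece u)))))
    ... | no ¬root = label≡inj₁ (inj₁ (to (proj₁ ψ) u)) (begin
          label (inj₁ (to (proj₁ ψ) u))  ≡⟨ cong label (ψ-commutes u) ⟩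
          label (to (proj₁ φ) (inj₁ u))  ≡⟨ preserves (inj₁ u) ⟩
          label (inj₁ u)                 ≡⟨ label-nonroot ¬root ⟩
          inj₁ (ℓ u)                     ∎)
      where open ≡.≡-Reasoning

  fixes-second-copy : ∀ φ → LabelPreserving φ → ∀ v → to (proj₁ φ) (inj₂ v) ≡ inj₂ v
  fixes-second-copy φ@(f , _) preserves v =
    ≡.trans (≡.sym (ψ-commutes v)) (cong inj₂ (ℓ-dist ψ ψ-preserves-ℓ v))
    where
    fixes₁ : ∀ u → to f (inj₁ u) ≡ inj₁ u
    fixes₁ = fixes-first-copy φ preserves
    restriction : Σ (Aut G) λ ψ → ∀ u → inj₂ (to (proj₁ ψ) u) ≡ to f (inj₂ u)
    restriction = Aut-restrict G Γ inj₂ inj₂-injective (λ _ _ → refl) φ (inj₂-preserved f fixes₁)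
      (inj₂-preserved (↔-sym f) (from-fixes f fixes₁))
    ψ : Aut G
    ψ = proj₁ restriction
    ψ-commutes : ∀ u → inj₂ (to (proj₁ ψ) u) ≡ to f (inj₂ u)
    ψ-commutes = proj₂ restriction
    ψ-preserves-ℓ : ∀ u → ℓ (to (proj₁ ψ) u) ≡ ℓ u
    ψ-preserves-ℓ u = label≡inj₁ (inj₂ (to (proj₁ ψ) u))
      (≡.trans (cong label (ψ-commutes u)) (preserves (inj₂ u)))

  LabelPreserving⇒identity : ∀ φ → LabelPreserving φ → ∀ x → to (proj₁ φ) x ≡ x
  LabelPreserving⇒identity φ preserves (inj₁ v) = fixes-first-copy φ preserves v
  LabelPreserving⇒identity φ preserves (inj₂ v) = fixes-second-copy φ preserves v

  distinguishing : Distinguishing Γ (join r m ∘ label)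
  distinguishing φ preserves = LabelPreserving⇒identity φ (to-injective (↔-sym +↔⊎) ∘ preserves)

theorem2p8 : {n : ℕ} (G : Graph (Fin n)) (k : ℕ) (A : Fin k → Subset (Fin n ⊎ Fin n)) →
    IsPartitionSeq G k A → (m : ℕ) → IsMaxClassSize G k A m →
    (dG dΓ : ℕ) → IsDistNum G dG → IsDistNum (double G) dΓ →
    (dG ≤ dΓ) × (dΓ ≤ dG + m)
theorem2p8 {n} G k A partition m (class-bounded , _) dG dΓ
  ((ℓ , ℓ-dist) , dG-least) ((ℓΓ , ℓΓ-dist) , dΓ-least) =
  dG-least dΓ (ℓΓ ∘ inj₁) (Distinguishing-first G ℓΓ ℓΓ-dist) ,
  -- The goal is decidable, so we may assume isomorphism of pieces decidable.
  decidable-stable (dΓ ≤? dG + m) (¬¬-map upper (¬¬-Π λ i → ¬¬-Π λ j → ¬¬-excluded-middle))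
  where
  Γ[A] : (i : Fin k) → Graph (Σ (Fin n ⊎ Fin n) (T ∘ A i))
  Γ[A] i = Induced (double G) (A i)
  PiecesIso : Rel (Fin k) 0ℓ
  PiecesIso i j = Iso (Γ[A] i) (Γ[A] j)
  PiecesIso-equiv : IsEquivalence PiecesIso
  PiecesIso-equiv = record
    { refl  = λ {i} → Iso-refl (Γ[A] i)
    ; sym   = λ {i j} → Iso-sym (Γ[A] i) (Γ[A] j)
    ; trans = λ {i j l} → Iso-trans (Γ[A] i) (Γ[A] j) (Γ[A] l)
    }
  upper : (∀ i j → Dec (PiecesIso i j)) → dΓ ≤ dG + m
  upper PiecesIso? = dΓ-least (dG + m) _
    (JoinLabeling.distinguishing G A partition ℓ ℓ-dist rank rank-injective)
    where open ClassRank PiecesIso? PiecesIso-equiv class-bounded
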